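{- Let $\mathbf{R}$ be a commutative ring, $g\in\mathbf{R}[[x^3]]$ and $f_1,f_2,f_3\in x\mathbf{R}[[x^3]]$, and let $a_{n,k}=[x^n]\,g(x)f_1(x)^{\lfloor (k+2)/3\rfloor}f_2(x)^{\lfloor (k+1)/3\rfloor}f_3(x)^{\lfloor k/3\rfloor}$. Then $$\sum_{n,k\ge0}a_{n,k}x^ny^k=\frac{g\,(1+yf_1+y^2f_1f_2)}{1-y^3f_1f_2f_3}.$$ In particular, the row sums $\sum_k a_{n,k}$ have generating function $\frac{g(1+f_1+f_1f_2)}{1-f_1f_2f_3}$ and the diagonal sums $\sum_{k} a_{n-k,k}$ have generating function $\frac{g(1+xf_1+x^2f_1f_2)}{1-x^3f_1f_2f_3}$.
   Context: $[x^n]$ denotes the coefficient of $x^n$. -}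

module Defs where

open import Algebra.Bundles using (CommutativeRing)
open import Data.Nat using (ℕ; zero; suc; _∸_; _≡ᵇ_)
open import Data.Nat.DivMod using (_%_)
open import Data.Bool using (if_then_else_)
open import Relation.Binary.PropositionalEquality using (_≡_)
open import Relation.Nullary using (¬_)

-- Series = R[[x]], Series₂ = R[[x,y]]
-- (coefficient of x^n y^k is  A n k).
module PowerSeries {c ℓ} (R : CommutativeRing c ℓ) where
  open CommutativeRing R

  Series : Set c
  Series = ℕ → Carrier

  Series₂ : Set c
  Series₂ = ℕ → ℕ → Carrier

  sumUpTo : (ℕ → Carrier) → ℕ → Carrier
  sumUpTo h zero = h 0
  sumUpTo h (suc n) = sumUpTo h n + h (suc n)

  infix  4 _≈ₛ_ _≈₂_
  infixl 6 _+ₛ_ _-ₛ_ _+₂_ _-₂_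
  infixl 7 _*ₛ_ _*₂_
  infixr 8 _^ₛ_ _^₂_

  _≈ₛ_ : Series → Series → Set ℓ
  f ≈ₛ g = ∀ n → f n ≈ g n

  1ₛ : Series
  1ₛ n = if n ≡ᵇ 0 then 1# else 0#

  X : Series
  X n = if n ≡ᵇ 1 then 1# else 0#

  _+ₛ_ : Series → Series → Series
  (f +ₛ g) n = f n + g n

  _-ₛ_ : Series → Series → Series
  (f -ₛ g) n = f n + - g n

  _*ₛ_ : Series → Series → Series
  (f *ₛ g) n = sumUpTo (λ i → f i * g (n ∸ i)) n

  _^ₛ_ : Series → ℕ → Series
  f ^ₛ zero = 1ₛ
  f ^ₛ suc m = f *ₛ (f ^ₛ m)

  _≈₂_ : Series₂ → Series₂ → Set ℓ
  A ≈₂ B = ∀ n k → A n k ≈ B n k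

  1₂ : Series₂
  1₂ n k = if n ≡ᵇ 0 then (if k ≡ᵇ 0 then 1# else 0#) else 0#

  Y : Series₂
  Y n k = if n ≡ᵇ 0 then (if k ≡ᵇ 1 then 1# else 0#) else 0#

  ι : Series → Series₂
  ι f n k = if k ≡ᵇ 0 then f n else 0#

  _+₂_ : Series₂ → Series₂ → Series₂
  (A +₂ B) n k = A n k + B n k

  _-₂_ : Series₂ → Series₂ → Series₂
  (A -₂ B) n k = A n k + - B n k

  _*₂_ : Series₂ → Series₂ → Series₂
  (A *₂ B) n k = sumUpTo (λ i → sumUpTo (λ j → A i j * B (n ∸ i) (k ∸ j)) k) n

  _^₂_ : Series₂ → ℕ → Series₂
  A ^₂ zero = 1₂
  A ^₂ suc m = A *₂ (A ^₂ m)

  InPow3 : Series → Set ℓ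
  InPow3 g = ∀ n → ¬ (n % 3 ≡ 0) → g n ≈ 0#

  InXPow3 : Series → Set ℓ
  InXPow3 f = ∀ n → ¬ (n % 3 ≡ 1) → f n ≈ 0#

{-# OPTIONS --safe #-}
module Submission where

-- With A k = g f₁^⌊(k+2)/3⌋ f₂^⌊(k+1)/3⌋ f₃^⌊k/3⌋ (so a n k = [xⁿ] A k) and F = f₁ f₂ f₃, raising
-- k by 3 raises each of the three exponents by one, so A (k + 3) = A k F.  Multiplying Σₖ A k by
-- 1 - F therefore telescopes to A 0 + A 1 + A 2 = g (1 + f₁ + f₁ f₂).  The sum converges x-adically:
-- the fᵢ have no constant term and the three exponents add up to k, so A k has order at least k,
-- and only k ≤ n contribute to the row sum of index n.  The families xᵏ A k and yᵏ A k satisfy the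
-- same recurrence with F replaced by x³ F and y³ F; this gives the diagonal identity and, reading
-- R[[x,y]] as R[[x]][[y]], the bivariate one.

open import Defs
open import Algebra.Bundles using (CommutativeRing)
open import Data.Nat using (ℕ; zero; suc; _+_; _∸_; _≤_; _<_; z≤n; s≤s; _<?_; _≡ᵇ_)
open import Data.Nat.DivMod using (_/_; m/n≡1+[m∸n]/n)
open import Data.Product using (_×_; _,_)
open import Data.Bool using (if_then_else_)
open import Data.Empty using (⊥-elim)
open import Data.Sum using (inj₁; inj₂)
open import Function using (_∘_)
open import Relation.Binary.Bundles using (Setoid)
open import Relation.Binary.PropositionalEquality as ≡ using (_≡_; _≢_)
open import Relation.Nullary using (yes; no)
import Data.Nat.Properties as ℕ
import Algebra.Consequences.Setoid as SetoidConsequences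
import Algebra.Construct.Pointwise as Pointwise
import Algebra.Properties.CommutativeSemigroup as CommutativeSemigroupProperties
import Algebra.Properties.Ring as RingProperties
import Algebra.Solver.CommutativeMonoid as CommutativeMonoidSolver
import Relation.Binary.Reasoning.Setoid as SetoidReasoning

module FiniteSums {c ℓ} (R : CommutativeRing c ℓ) where
  open CommutativeRing R renaming (_+_ to _⊕_)
  open PowerSeries R using (sumUpTo)
  open CommutativeSemigroupProperties +-commutativeSemigroup using (interchange)
  open SetoidReasoning setoid

  sumUpTo-cong : ∀ {f h} n → (∀ i → i ≤ n → f i ≈ h i) → sumUpTo f n ≈ sumUpTo h n
  sumUpTo-cong zero f≈h = f≈h 0 z≤n
  sumUpTo-cong (suc n) f≈h =
    +-cong (sumUpTo-cong n (λ i i≤n → f≈h i (ℕ.m≤n⇒m≤1+n i≤n))) (f≈h (suc n) ℕ.≤-refl)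

  sumUpTo-zero : ∀ {f} n → (∀ i → i ≤ n → f i ≈ 0#) → sumUpTo f n ≈ 0#
  sumUpTo-zero zero f≈0 = f≈0 0 z≤n
  sumUpTo-zero (suc n) f≈0 =
    trans (+-cong (sumUpTo-zero n (λ i i≤n → f≈0 i (ℕ.m≤n⇒m≤1+n i≤n))) (f≈0 (suc n) ℕ.≤-refl))
          (+-identityˡ 0#)

  sumUpTo-+ : ∀ {f h} n → sumUpTo (λ i → f i ⊕ h i) n ≈ sumUpTo f n ⊕ sumUpTo h n
  sumUpTo-+ zero = refl
  sumUpTo-+ (suc n) = trans (+-congʳ (sumUpTo-+ n)) (interchange _ _ _ _)

  *-distribˡ-sumUpTo : ∀ {f} x n → x * sumUpTo f n ≈ sumUpTo (λ i → x * f i) n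
  *-distribˡ-sumUpTo x zero = refl
  *-distribˡ-sumUpTo x (suc n) = trans (distribˡ x _ _) (+-congʳ (*-distribˡ-sumUpTo x n))

  *-distribʳ-sumUpTo : ∀ {f} x n → sumUpTo f n * x ≈ sumUpTo (λ i → f i * x) n
  *-distribʳ-sumUpTo x zero = refl
  *-distribʳ-sumUpTo x (suc n) = trans (distribʳ x _ _) (+-congʳ (*-distribʳ-sumUpTo x n))

  sumUpTo-suc : ∀ {f} n → sumUpTo f (suc n) ≈ f 0 ⊕ sumUpTo (f ∘ suc) n
  sumUpTo-suc zero = refl
  sumUpTo-suc (suc n) = trans (+-congʳ (sumUpTo-suc n)) (+-assoc _ _ _)

  sumUpTo-split : ∀ {f} m n → sumUpTo f (suc (m + n)) ≈ sumUpTo f m ⊕ sumUpTo (λ k → f (suc (m + k))) n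
  sumUpTo-split m zero rewrite ℕ.+-identityʳ m = refl
  sumUpTo-split m (suc n) rewrite ℕ.+-suc m n =
    trans (+-congʳ (sumUpTo-split m n)) (+-assoc _ _ _)

  sumUpTo-single : ∀ {f} m n → m ≤ n → (∀ j → j ≤ n → j ≢ m → f j ≈ 0#) → sumUpTo f n ≈ f m
  sumUpTo-single _ zero z≤n _ = refl
  sumUpTo-single m (suc n) m≤1+n f≈0 with ℕ.m≤n⇒m<n∨m≡n m≤1+n
  ... | inj₂ ≡.refl =
    trans (+-congʳ (sumUpTo-zero n (λ j j≤n → f≈0 j (ℕ.m≤n⇒m≤1+n j≤n) (ℕ.<⇒≢ (s≤s j≤n)))))
          (+-identityˡ _)
  ... | inj₁ (s≤s m≤n) =
    trans (+-cong (sumUpTo-single m n m≤n (λ j j≤n → f≈0 j (ℕ.m≤n⇒m≤1+n j≤n)))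
                  (f≈0 (suc n) ℕ.≤-refl (≡.≢-sym (ℕ.<⇒≢ (s≤s m≤n)))))
          (+-identityʳ _)

  sumUpTo-extend : ∀ {f} m n → m ≤ n → (∀ j → m < j → j ≤ n → f j ≈ 0#) → sumUpTo f m ≈ sumUpTo f n
  sumUpTo-extend m n m≤n f≈0 with ℕ.m≤n⇒m<n∨m≡n m≤n
  ... | inj₂ ≡.refl = refl
  sumUpTo-extend m (suc n) _ f≈0 | inj₁ (s≤s m≤n) =
    trans (sumUpTo-extend m n m≤n (λ j m<j j≤n → f≈0 j m<j (ℕ.m≤n⇒m≤1+n j≤n)))
          (sym (trans (+-congˡ (f≈0 (suc n) (s≤s m≤n) ℕ.≤-refl)) (+-identityʳ _)))

  sumUpTo-comm : ∀ {h : ℕ → ℕ → Carrier} m n →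
    sumUpTo (λ i → sumUpTo (λ j → h i j) m) n ≈ sumUpTo (λ j → sumUpTo (λ i → h i j) n) m
  sumUpTo-comm zero zero = refl
  sumUpTo-comm {h} zero (suc n) = +-congʳ (sumUpTo-comm {h} 0 n)
  sumUpTo-comm {h} (suc m) n = trans (sumUpTo-+ n) (+-congʳ (sumUpTo-comm {h} m n))

  sumUpTo-reverse : ∀ {f} n → sumUpTo f n ≈ sumUpTo (λ i → f (n ∸ i)) n
  sumUpTo-reverse zero = refl
  sumUpTo-reverse {f} (suc n) = begin
    sumUpTo f n ⊕ f (suc n)                  ≈⟨ +-congʳ (sumUpTo-reverse n) ⟩
    sumUpTo (λ i → f (n ∸ i)) n ⊕ f (suc n)  ≈⟨ +-comm _ _ ⟩
    f (suc n) ⊕ sumUpTo (λ i → f (n ∸ i)) n  ≈⟨ sumUpTo-suc n ⟨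
    sumUpTo (λ i → f (suc n ∸ i)) (suc n)    ∎

  sumUpTo-triangle : ∀ {ψ : ℕ → ℕ → Carrier} n →
    sumUpTo (λ i → sumUpTo (λ j → ψ j i) i) n ≈ sumUpTo (λ j → sumUpTo (λ l → ψ j (j + l)) (n ∸ j)) n
  sumUpTo-triangle zero = refl
  sumUpTo-triangle {ψ} (suc n) = begin
    sumUpTo (λ i → sumUpTo (λ j → ψ j i) i) n ⊕ (column ⊕ ψ (suc n) (suc n))
      ≈⟨ +-assoc _ _ _ ⟨
    (sumUpTo (λ i → sumUpTo (λ j → ψ j i) i) n ⊕ column) ⊕ ψ (suc n) (suc n)
      ≈⟨ +-congʳ (+-congʳ (sumUpTo-triangle n)) ⟩
    (sumUpTo (λ j → row j n) n ⊕ column) ⊕ ψ (suc n) (suc n)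
      ≈⟨ +-congʳ (sumUpTo-+ n) ⟨
    sumUpTo (λ j → row j n ⊕ ψ j (suc n)) n ⊕ ψ (suc n) (suc n)
      ≈⟨ +-cong (sumUpTo-cong n row-suc) (reflexive (≡.sym last-row)) ⟩
    sumUpTo (λ j → row j (suc n)) n ⊕ row (suc n) (suc n) ∎
    where
    column : Carrier
    column = sumUpTo (λ j → ψ j (suc n)) n

    row : ℕ → ℕ → Carrier
    row j m = sumUpTo (λ l → ψ j (j + l)) (m ∸ j)

    row-suc : ∀ j → j ≤ n → row j n ⊕ ψ j (suc n) ≈ row j (suc n)
    row-suc j j≤n rewrite ℕ.+-∸-assoc 1 j≤n =
      +-congˡ (reflexive (≡.cong (ψ j) (≡.trans (≡.cong suc (≡.sym (ℕ.m+[n∸m]≡n j≤n))) (≡.sym (ℕ.+-suc j (n ∸ j))))))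

    last-row : row (suc n) (suc n) ≡ ψ (suc n) (suc n)
    last-row rewrite ℕ.n∸n≡0 n | ℕ.+-identityʳ n = ≡.refl

module SeriesRing {c ℓ} (R : CommutativeRing c ℓ) where
  open CommutativeRing R renaming (_+_ to _⊕_)
  open PowerSeries R
  open FiniteSums R
  open SetoidReasoning setoid

  0ₛ : Series
  0ₛ _ = 0#

  -ₛ_ : Series → Series
  (-ₛ f) n = - f n

  seriesSetoid : Setoid c ℓ
  seriesSetoid = record { Carrier = Series ; _≈_ = _≈ₛ_ ; isEquivalence = Pointwise.isEquivalence ℕ isEquivalence }

  *ₛ-cong : ∀ {f f′ h h′} → f ≈ₛ f′ → h ≈ₛ h′ → f *ₛ h ≈ₛ f′ *ₛ h′
  *ₛ-cong f≈f′ h≈h′ n = sumUpTo-cong n (λ i _ → *-cong (f≈f′ i) (h≈h′ (n ∸ i)))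

  *ₛ-congˡ : ∀ f {h h′} → h ≈ₛ h′ → f *ₛ h ≈ₛ f *ₛ h′
  *ₛ-congˡ f = *ₛ-cong {f = f} (λ _ → refl)

  *ₛ-congʳ : ∀ h {f f′} → f ≈ₛ f′ → f *ₛ h ≈ₛ f′ *ₛ h
  *ₛ-congʳ h f≈f′ = *ₛ-cong {h = h} f≈f′ (λ _ → refl)

  *ₛ-comm : ∀ f h → f *ₛ h ≈ₛ h *ₛ f
  *ₛ-comm f h n = trans (sumUpTo-reverse n) (sumUpTo-cong n (λ i i≤n →
    trans (*-comm _ _) (*-congʳ (reflexive (≡.cong h (ℕ.m∸[m∸n]≡n i≤n))))))

  constant : Carrier → Series
  constant a n = if n ≡ᵇ 0 then a else 0#

  constant-cong : ∀ {a b} → a ≈ b → constant a ≈ₛ constant b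
  constant-cong a≈b zero = a≈b
  constant-cong a≈b (suc n) = refl

  constant-pos : ∀ a {n} → 0 < n → constant a n ≈ 0#
  constant-pos a {suc n} _ = refl

  constant-*ₛ : ∀ a f → constant a *ₛ f ≈ₛ (λ n → a * f n)
  constant-*ₛ a f n = sumUpTo-single 0 n z≤n (λ { zero _ 0≢0 → ⊥-elim (0≢0 ≡.refl) ; (suc j) _ _ → zeroˡ _ })

  constant-* : ∀ a b → constant (a * b) ≈ₛ constant a *ₛ constant b
  constant-* a b zero = sym (constant-*ₛ a (constant b) 0)
  constant-* a b (suc n) = sym (trans (constant-*ₛ a (constant b) (suc n)) (zeroʳ a))

  *ₛ-identityˡ : ∀ f → 1ₛ *ₛ f ≈ₛ f
  *ₛ-identityˡ f n = trans (constant-*ₛ 1# f n) (*-identityˡ (f n))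

  *ₛ-distribˡ-+ : ∀ f g h → f *ₛ (g +ₛ h) ≈ₛ f *ₛ g +ₛ f *ₛ h
  *ₛ-distribˡ-+ f g h n = trans (sumUpTo-cong n (λ i _ → distribˡ _ _ _)) (sumUpTo-+ n)

  *ₛ-assoc : ∀ f g h → (f *ₛ g) *ₛ h ≈ₛ f *ₛ (g *ₛ h)
  *ₛ-assoc f g h n = begin
    sumUpTo (λ i → sumUpTo (λ j → f j * g (i ∸ j)) i * h (n ∸ i)) n
      ≈⟨ sumUpTo-cong n (λ i _ → *-distribʳ-sumUpTo (h (n ∸ i)) i) ⟩
    sumUpTo (λ i → sumUpTo (λ j → (f j * g (i ∸ j)) * h (n ∸ i)) i) n
      ≈⟨ sumUpTo-triangle n ⟩
    sumUpTo (λ j → sumUpTo (λ l → (f j * g (j + l ∸ j)) * h (n ∸ (j + l))) (n ∸ j)) n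
      ≈⟨ sumUpTo-cong n (λ j _ → sumUpTo-cong (n ∸ j) (λ l _ → trans (*-assoc _ _ _)
           (*-congˡ (reflexive (≡.cong₂ (λ p q → g p * h q) (ℕ.m+n∸m≡n j l) (≡.sym (ℕ.∸-+-assoc n j l))))))) ⟩
    sumUpTo (λ j → sumUpTo (λ l → f j * (g l * h (n ∸ j ∸ l))) (n ∸ j)) n
      ≈⟨ sumUpTo-cong n (λ j _ → *-distribˡ-sumUpTo (f j) (n ∸ j)) ⟨
    sumUpTo (λ j → f j * sumUpTo (λ l → g l * h (n ∸ j ∸ l)) (n ∸ j)) n ∎

  ^ₛ-cong : ∀ {f h} → f ≈ₛ h → ∀ m → f ^ₛ m ≈ₛ h ^ₛ m
  ^ₛ-cong f≈h zero n = refl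
  ^ₛ-cong f≈h (suc m) = *ₛ-cong f≈h (^ₛ-cong f≈h m)

  ^ₛ-+ : ∀ f m k → f ^ₛ (m + k) ≈ₛ f ^ₛ m *ₛ f ^ₛ k
  ^ₛ-+ f zero k n = sym (*ₛ-identityˡ (f ^ₛ k) n)
  ^ₛ-+ f (suc m) k n =
    trans (*ₛ-congˡ f (^ₛ-+ f m k) n) (sym (*ₛ-assoc f (f ^ₛ m) (f ^ₛ k) n))

  seriesRing : CommutativeRing c ℓ
  seriesRing = record
    { Carrier = Series
    ; _≈_ = _≈ₛ_
    ; _+_ = _+ₛ_
    ; _*_ = _*ₛ_
    ; -_ = -ₛ_
    ; 0# = 0ₛ
    ; 1# = 1ₛ
    ; isCommutativeRing = record
      { isRing = record
        { +-isAbelianGroup = Pointwise.isAbelianGroup ℕ +-isAbelianGroup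
        ; *-cong = *ₛ-cong
        ; *-assoc = *ₛ-assoc
        ; *-identity = comm∧idˡ⇒id *ₛ-comm *ₛ-identityˡ
        ; distrib = comm∧distrˡ⇒distr (λ f≈f′ h≈h′ n → +-cong (f≈f′ n) (h≈h′ n)) *ₛ-comm *ₛ-distribˡ-+
        }
      ; *-comm = *ₛ-comm
      }
    }
    where open SetoidConsequences seriesSetoid using (comm∧idˡ⇒id; comm∧distrˡ⇒distr)

  module R[[x]] = CommutativeRing seriesRing

module Order {c ℓ} (R : CommutativeRing c ℓ) where
  open CommutativeRing R renaming (_+_ to _⊕_)
  open PowerSeries R
  open FiniteSums R
  open SeriesRing R

  HasOrder : ℕ → Series → Set ℓ
  HasOrder p f = ∀ n → n < p → f n ≈ 0#

  InXPow3⇒HasOrder1 : ∀ {f} → InXPow3 f → HasOrder 1 f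
  InXPow3⇒HasOrder1 f∈xR[[x³]] zero _ = f∈xR[[x³]] 0 (λ ())
  InXPow3⇒HasOrder1 f∈xR[[x³]] (suc n) (s≤s ())

  order-≤ : ∀ {p q f} → q ≤ p → HasOrder p f → HasOrder q f
  order-≤ q≤p f-ord n n<q = f-ord n (ℕ.<-≤-trans n<q q≤p)

  order-* : ∀ {p q f h} → HasOrder p f → HasOrder q h → HasOrder (p + q) (f *ₛ h)
  order-* {p} {q} {f} {h} f-ord h-ord n n<p+q = sumUpTo-zero n term
    where
    term : ∀ i → i ≤ n → f i * h (n ∸ i) ≈ 0#
    term i i≤n with i <? p
    ... | yes i<p = trans (*-congʳ (f-ord i i<p)) (zeroˡ _)
    ... | no i≮p = trans (*-congˡ (h-ord (n ∸ i) n∸i<q)) (zeroʳ _)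
      where
      n∸i<q : n ∸ i < q
      n∸i<q = ℕ.<-≤-trans (ℕ.∸-monoˡ-< n<p+q i≤n)
                (ℕ.≤-trans (ℕ.∸-monoʳ-≤ (p + q) (ℕ.≮⇒≥ i≮p)) (ℕ.≤-reflexive (ℕ.m+n∸m≡n p q)))

  order-^ : ∀ {f} → HasOrder 1 f → ∀ m → HasOrder m (f ^ₛ m)
  order-^ f-ord zero n ()
  order-^ f-ord (suc m) = order-* f-ord (order-^ f-ord m)

  X-order : HasOrder 1 X
  X-order zero _ = refl
  X-order (suc n) (s≤s ())

  X*-suc : ∀ h n → (X *ₛ h) (suc n) ≈ h n
  X*-suc h n = trans (sumUpTo-single 1 (suc n) (s≤s z≤n) X-vanishes) (*-identityˡ (h n))
    where
    X-vanishes : ∀ j → j ≤ suc n → j ≢ 1 → X j * h (suc n ∸ j) ≈ 0#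
    X-vanishes zero _ _ = zeroˡ _
    X-vanishes (suc zero) _ 1≢1 = ⊥-elim (1≢1 ≡.refl)
    X-vanishes (suc (suc j)) _ _ = zeroˡ _

  X^-*-order : ∀ k h → HasOrder k (X ^ₛ k *ₛ h)
  X^-*-order k h = order-≤ (ℕ.m≤m+n k 0) (order-* {h = h} (order-^ X-order k) (λ _ ()))

  X^-*-+ : ∀ k h m → (X ^ₛ k *ₛ h) (k + m) ≈ h m
  X^-*-+ zero h m = *ₛ-identityˡ h m
  X^-*-+ (suc k) h m =
    trans (*ₛ-assoc X (X ^ₛ k) h (suc (k + m))) (trans (X*-suc (X ^ₛ k *ₛ h) (k + m)) (X^-*-+ k h m))

  X^-*-∸ : ∀ k h n → k ≤ n → (X ^ₛ k *ₛ h) n ≈ h (n ∸ k)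
  X^-*-∸ k h n k≤n = trans (reflexive (≡.cong (X ^ₛ k *ₛ h) (≡.sym (ℕ.m+[n∸m]≡n k≤n)))) (X^-*-+ k h (n ∸ k))

module Telescoping {c ℓ} (R : CommutativeRing c ℓ) where
  open CommutativeRing R renaming (_+_ to _⊕_)
  open PowerSeries R
  open FiniteSums R
  open SeriesRing R
  open Order R

  -- For such a family ∑ b is its x-adic sum: b k does not contribute to xⁿ when k > n.
  Summable : (ℕ → Series) → Set ℓ
  Summable b = ∀ k → HasOrder k (b k)

  ∑ : (ℕ → Series) → Series
  ∑ b n = sumUpTo (λ k → b k n) n

  ∑-cong : ∀ {b b′} → (∀ k → b k ≈ₛ b′ k) → ∑ b ≈ₛ ∑ b′
  ∑-cong b≈b′ n = sumUpTo-cong n (λ k _ → b≈b′ k n)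

  ∑-extend : ∀ {b n N} → Summable b → n ≤ N → ∑ b n ≈ sumUpTo (λ k → b k n) N
  ∑-extend {n = n} {N} b-sum n≤N = sumUpTo-extend n N n≤N (λ k n<k _ → b-sum k n n<k)

  ∑-*ₛ : ∀ {b} → Summable b → ∀ G → ∑ b *ₛ G ≈ₛ ∑ (λ k → b k *ₛ G)
  ∑-*ₛ {b} b-sum G n = begin
    sumUpTo (λ i → ∑ b i * G (n ∸ i)) n
      ≈⟨ sumUpTo-cong n (λ i i≤n → *-congʳ (∑-extend b-sum i≤n)) ⟩
    sumUpTo (λ i → sumUpTo (λ k → b k i) n * G (n ∸ i)) n
      ≈⟨ sumUpTo-cong n (λ i _ → *-distribʳ-sumUpTo (G (n ∸ i)) n) ⟩
    sumUpTo (λ i → sumUpTo (λ k → b k i * G (n ∸ i)) n) n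
      ≈⟨ sumUpTo-comm n n ⟩
    sumUpTo (λ k → (b k *ₛ G) n) n ∎
    where open SetoidReasoning setoid

  ∑-split : ∀ {b} → Summable b → ∀ e → ∑ b ≈ₛ (λ n → sumUpTo (λ k → b k n) e) +ₛ ∑ (λ k → b (suc e + k))
  ∑-split b-sum e n = trans (∑-extend b-sum (ℕ.m≤n+m n (suc e))) (sumUpTo-split e n)

  telescope : ∀ e {b} G → Summable b → (∀ k → b (suc e + k) ≈ₛ b k *ₛ G) →
    ∑ b *ₛ (1ₛ -ₛ G) ≈ₛ (λ n → sumUpTo (λ k → b k n) e)
  telescope e {b} G b-sum b-rec = begin
    ∑ b *ₛ (1ₛ -ₛ G)                   ≈⟨ x[y-z]≈xy-xz (∑ b) 1ₛ G ⟩
    ∑ b *ₛ 1ₛ -ₛ ∑ b *ₛ G             ≈⟨ R[[x]].+-cong (R[[x]].*-identityʳ (∑ b)) (R[[x]].-‿cong (∑-*ₛ b-sum G)) ⟩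
    ∑ b -ₛ ∑ (λ k → b k *ₛ G)          ≈⟨ R[[x]].+-cong (∑-split b-sum e) (R[[x]].-‿cong (∑-cong (λ k → R[[x]].sym (b-rec k)))) ⟩
    (head +ₛ tail) -ₛ tail             ≈⟨ //-rightDividesʳ tail head ⟩
    head                               ∎
    where
    open RingProperties (CommutativeRing.ring seriesRing) using (x[y-z]≈xy-xz; //-rightDividesʳ)
    open SetoidReasoning seriesSetoid
    head tail : Series
    head n = sumUpTo (λ k → b k n) e
    tail = ∑ (λ k → b (suc e + k))

  diagonal : (ℕ → Series) → Series
  diagonal c n = sumUpTo (λ k → c k (n ∸ k)) n

  diagonal-constant : ∀ c → diagonal (λ k → constant (c k)) ≈ₛ c
  diagonal-constant c n =
    trans (sumUpTo-single n n ℕ.≤-refl (λ j j≤n j≢n → constant-pos (c j) (ℕ.m<n⇒0<n∸m (ℕ.≤∧≢⇒< j≤n j≢n))))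
          (reflexive (≡.cong (constant (c n)) (ℕ.n∸n≡0 n)))

  diagonal≈∑ : ∀ c → diagonal c ≈ₛ ∑ (λ k → X ^ₛ k *ₛ c k)
  diagonal≈∑ c n = sumUpTo-cong n (λ k k≤n → sym (X^-*-∸ k (c k) n k≤n))

  telescope-diagonal : ∀ e {c} G → (∀ k → c (suc e + k) ≈ₛ c k *ₛ G) →
    diagonal c *ₛ (1ₛ -ₛ X ^ₛ suc e *ₛ G) ≈ₛ (λ n → sumUpTo (λ k → (X ^ₛ k *ₛ c k) n) e)
  telescope-diagonal e {c} G c-rec =
    R[[x]].trans (*ₛ-congʳ (1ₛ -ₛ X ^ₛ suc e *ₛ G) (diagonal≈∑ c))
                 (telescope e (X ^ₛ suc e *ₛ G) (λ k → X^-*-order k (c k)) Xc-rec)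
    where
    open CommutativeSemigroupProperties R[[x]].*-commutativeSemigroup using (interchange)
    open SetoidReasoning seriesSetoid
    Xc-rec : ∀ k → X ^ₛ (suc e + k) *ₛ c (suc e + k) ≈ₛ (X ^ₛ k *ₛ c k) *ₛ (X ^ₛ suc e *ₛ G)
    Xc-rec k = begin
      X ^ₛ (suc e + k) *ₛ c (suc e + k)       ≈⟨ R[[x]].*-cong (^ₛ-+ X (suc e) k) (c-rec k) ⟩
      (X ^ₛ suc e *ₛ X ^ₛ k) *ₛ (c k *ₛ G)    ≈⟨ *ₛ-congʳ (c k *ₛ G) (*ₛ-comm (X ^ₛ suc e) (X ^ₛ k)) ⟩
      (X ^ₛ k *ₛ X ^ₛ suc e) *ₛ (c k *ₛ G)    ≈⟨ interchange (X ^ₛ k) (X ^ₛ suc e) (c k) G ⟩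
      (X ^ₛ k *ₛ c k) *ₛ (X ^ₛ suc e *ₛ G)    ∎

module Bivariate {c ℓ} (R : CommutativeRing c ℓ) where
  open CommutativeRing R renaming (_+_ to _⊕_)
  open PowerSeries R
  open FiniteSums R
  open SeriesRing R using (seriesRing)

  open PowerSeries seriesRing public using () renaming
    (Series to Seriesʸ; _≈ₛ_ to _≈ʸ_; _+ₛ_ to _+ʸ_; _-ₛ_ to _-ʸ_; _*ₛ_ to _*ʸ_; _^ₛ_ to _^ʸ_;
     1ₛ to 1ʸ; X to y; sumUpTo to sumUpToʸ)
  open SeriesRing seriesRing public using () renaming
    (seriesRing to seriesRingʸ; constant to constantʸ; constant-cong to constantʸ-cong; constant-* to constantʸ-*;
     *ₛ-congˡ to *ʸ-congˡ; *ₛ-congʳ to *ʸ-congʳ; ^ₛ-cong to ^ʸ-cong)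

  module R[[x]][[y]] = CommutativeRing seriesRingʸ

  columns : Series₂ → Seriesʸ
  columns A k n = A n k

  columns-injective : ∀ {A B} → columns A ≈ʸ columns B → A ≈₂ B
  columns-injective A≈B n k = A≈B k n

  sumUpToʸ-apply : ∀ (h : ℕ → Series) k n → sumUpToʸ h k n ≡ sumUpTo (λ j → h j n) k
  sumUpToʸ-apply h zero n = ≡.refl
  sumUpToʸ-apply h (suc k) n = ≡.cong (_⊕ h (suc k) n) (sumUpToʸ-apply h k n)

  columns-*₂ : ∀ A B → columns (A *₂ B) ≈ʸ columns A *ʸ columns B
  columns-*₂ A B k n =
    trans (sumUpTo-comm k n) (reflexive (≡.sym (sumUpToʸ-apply (λ j → columns A j *ₛ columns B (k ∸ j)) k n)))

  columns-1₂ : columns 1₂ ≈ʸ 1ʸ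
  columns-1₂ zero n = refl
  columns-1₂ (suc k) zero = refl
  columns-1₂ (suc k) (suc n) = refl

  columns-Y : columns Y ≈ʸ y
  columns-Y zero zero = refl
  columns-Y zero (suc n) = refl
  columns-Y (suc zero) zero = refl
  columns-Y (suc zero) (suc n) = refl
  columns-Y (suc (suc k)) zero = refl
  columns-Y (suc (suc k)) (suc n) = refl

  columns-ι : ∀ f → columns (ι f) ≈ʸ constantʸ f
  columns-ι f zero n = refl
  columns-ι f (suc k) n = refl

  columns-^₂ : ∀ A m → columns (A ^₂ m) ≈ʸ columns A ^ʸ m
  columns-^₂ A zero = columns-1₂
  columns-^₂ A (suc m) = λ k n → trans (columns-*₂ A (A ^₂ m) k n) (*ʸ-congˡ (columns A) (columns-^₂ A m) k n)

  columns-*ι : ∀ A f → columns (A *₂ ι f) ≈ʸ columns A *ʸ constantʸ f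
  columns-*ι A f k n = trans (columns-*₂ A (ι f) k n) (*ʸ-congˡ (columns A) (columns-ι f) k n)

  columns-Y^ : ∀ m → columns (Y ^₂ m) ≈ʸ y ^ʸ m
  columns-Y^ m = R[[x]][[y]].trans (columns-^₂ Y m) (^ʸ-cong columns-Y m)

module Factoring {c ℓ} (T : CommutativeRing c ℓ) where
  open CommutativeRing T renaming (_+_ to _⊕_)
  open import Algebra.Properties.Semiring.Exp semiring using (_^_)
  open CommutativeSemigroupProperties *-commutativeSemigroup using (x∙yz≈y∙xz)
  open SetoidReasoning setoid

  factor-+₃ : ∀ {g b₀ b₁ b₂ t₁ t₂} → b₀ ≈ g → b₁ ≈ g * t₁ → b₂ ≈ g * t₂ →
    b₀ ⊕ b₁ ⊕ b₂ ≈ g * (1# ⊕ t₁ ⊕ t₂)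
  factor-+₃ {g} {b₀} {b₁} {b₂} {t₁} {t₂} b₀≈g b₁≈gt₁ b₂≈gt₂ = begin
    b₀ ⊕ b₁ ⊕ b₂              ≈⟨ +-cong (+-cong (trans b₀≈g (sym (*-identityʳ g))) b₁≈gt₁) b₂≈gt₂ ⟩
    g * 1# ⊕ g * t₁ ⊕ g * t₂  ≈⟨ +-congʳ (distribˡ g 1# t₁) ⟨
    g * (1# ⊕ t₁) ⊕ g * t₂    ≈⟨ distribˡ g (1# ⊕ t₁) t₂ ⟨
    g * (1# ⊕ t₁ ⊕ t₂)        ∎

  -- On numerals w ^ n unfolds to w * (⋯ * 1#), so w ^ n is X ^ₛ n when w is X.
  factor-+₃-weighted : ∀ w {g b₀ b₁ b₂ t₁ t₂} → b₀ ≈ g → b₁ ≈ g * t₁ → b₂ ≈ g * t₂ →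
    w ^ 0 * b₀ ⊕ w ^ 1 * b₁ ⊕ w ^ 2 * b₂ ≈ g * (1# ⊕ w * t₁ ⊕ w ^ 2 * t₂)
  factor-+₃-weighted w {g} {t₁ = t₁} {t₂} b₀≈g b₁≈gt₁ b₂≈gt₂ = factor-+₃
    (trans (*-identityˡ _) b₀≈g)
    (trans (*-cong (*-identityʳ w) b₁≈gt₁) (x∙yz≈y∙xz w g t₁))
    (trans (*-congˡ b₂≈gt₂) (x∙yz≈y∙xz (w ^ 2) g t₂))

[3+m]/3≡1+m/3 : ∀ m → (3 + m) / 3 ≡ suc (m / 3)
[3+m]/3≡1+m/3 m = m/n≡1+[m∸n]/n (ℕ.m≤m+n 3 m)

[k+2]/3+[k+1]/3+k/3≡k : ∀ k → (k + 2) / 3 + (k + 1) / 3 + k / 3 ≡ k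
[k+2]/3+[k+1]/3+k/3≡k zero = ≡.refl
[k+2]/3+[k+1]/3+k/3≡k (suc zero) = ≡.refl
[k+2]/3+[k+1]/3+k/3≡k (suc (suc zero)) = ≡.refl
[k+2]/3+[k+1]/3+k/3≡k (suc (suc (suc k)))
  rewrite [3+m]/3≡1+m/3 (k + 2) | [3+m]/3≡1+m/3 (k + 1) | [3+m]/3≡1+m/3 k
        | ℕ.+-suc ((k + 2) / 3) ((k + 1) / 3) | ℕ.+-suc ((k + 2) / 3 + (k + 1) / 3) (k / 3)
  = ≡.cong (suc ∘ suc ∘ suc) ([k+2]/3+[k+1]/3+k/3≡k k)

module PeriodicProducts {c ℓ} (R : CommutativeRing c ℓ) (g f₁ f₂ f₃ : PowerSeries.Series R) where
  open PowerSeries R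
  open SeriesRing R
  open Order R
  open Telescoping R
  open Bivariate R
  open Factoring seriesRing using (factor-+₃; factor-+₃-weighted)

  A : ℕ → Series
  A k = g *ₛ f₁ ^ₛ ((k + 2) / 3) *ₛ f₂ ^ₛ ((k + 1) / 3) *ₛ f₃ ^ₛ (k / 3)

  F : Series
  F = f₁ *ₛ f₂ *ₛ f₃

  A-rec : ∀ k → A (3 + k) ≈ₛ A k *ₛ F
  A-rec k rewrite [3+m]/3≡1+m/3 (k + 2) | [3+m]/3≡1+m/3 (k + 1) | [3+m]/3≡1+m/3 k =
    solve 7 (λ h a₁ a₂ a₃ p₁ p₂ p₃ →
               ((h ⊕ (a₁ ⊕ p₁)) ⊕ (a₂ ⊕ p₂)) ⊕ (a₃ ⊕ p₃) ⊜ (((h ⊕ p₁) ⊕ p₂) ⊕ p₃) ⊕ ((a₁ ⊕ a₂) ⊕ a₃))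
          R[[x]].refl g f₁ f₂ f₃ (f₁ ^ₛ ((k + 2) / 3)) (f₂ ^ₛ ((k + 1) / 3)) (f₃ ^ₛ (k / 3))
    where open CommutativeMonoidSolver R[[x]].*-commutativeMonoid using (solve; _⊜_; _⊕_)

  A-summable : HasOrder 1 f₁ → HasOrder 1 f₂ → HasOrder 1 f₃ → Summable A
  A-summable f₁-ord f₂-ord f₃-ord k =
    order-≤ (ℕ.≤-reflexive (≡.sym ([k+2]/3+[k+1]/3+k/3≡k k)))
      (order-* (order-* (order-* {p = 0} {f = g} (λ _ ()) (order-^ f₁-ord ((k + 2) / 3)))
                        (order-^ f₂-ord ((k + 1) / 3)))
               (order-^ f₃-ord (k / 3)))

  A-0 : A 0 ≈ₛ g
  A-0 = R[[x]].trans (R[[x]].*-identityʳ _) (R[[x]].trans (R[[x]].*-identityʳ _) (R[[x]].*-identityʳ g))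

  A-1 : A 1 ≈ₛ g *ₛ f₁
  A-1 = R[[x]].trans (R[[x]].*-identityʳ _) (R[[x]].trans (R[[x]].*-identityʳ _) (*ₛ-congˡ g (R[[x]].*-identityʳ f₁)))

  A-2 : A 2 ≈ₛ g *ₛ (f₁ *ₛ f₂)
  A-2 = R[[x]].trans (R[[x]].*-identityʳ _)
          (R[[x]].trans (R[[x]].*-cong (*ₛ-congˡ g (R[[x]].*-identityʳ f₁)) (R[[x]].*-identityʳ f₂)) (R[[x]].*-assoc g f₁ f₂))

  rows : Summable A → ∑ A *ₛ (1ₛ -ₛ F) ≈ₛ g *ₛ (1ₛ +ₛ f₁ +ₛ f₁ *ₛ f₂)
  rows A-sum = R[[x]].trans (telescope 2 F A-sum A-rec) (factor-+₃ {t₁ = f₁} {t₂ = f₁ *ₛ f₂} A-0 A-1 A-2)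

  diagonals : diagonal A *ₛ (1ₛ -ₛ X ^ₛ 3 *ₛ F) ≈ₛ g *ₛ (1ₛ +ₛ X *ₛ f₁ +ₛ X ^ₛ 2 *ₛ (f₁ *ₛ f₂))
  diagonals = R[[x]].trans (telescope-diagonal 2 F A-rec) (factor-+₃-weighted X {t₁ = f₁} {t₂ = f₁ *ₛ f₂} A-0 A-1 A-2)

  bivariate : (λ n k → A k n) *₂ (1₂ -₂ Y ^₂ 3 *₂ ι F) ≈₂ ι g *₂ (1₂ +₂ Y *₂ ι f₁ +₂ Y ^₂ 2 *₂ ι (f₁ *ₛ f₂))
  bivariate = columns-injective (begin
    columns ((λ n k → A k n) *₂ (1₂ -₂ Y ^₂ 3 *₂ ι F))
      ≈⟨ lhs-columns ⟩
    A *ʸ (1ʸ -ʸ y ^ʸ 3 *ʸ constantʸ F)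
      ≈⟨ *ʸ-congʳ (1ʸ -ʸ y ^ʸ 3 *ʸ constantʸ F) (diagonal-constantʸ A) ⟨
    diagonalʸ (λ k → constantʸ (A k)) *ʸ (1ʸ -ʸ y ^ʸ 3 *ʸ constantʸ F)
      ≈⟨ telescope-diagonalʸ 2 (constantʸ F) constant-A-rec ⟩
    y ^ʸ 0 *ʸ constantʸ (A 0) +ʸ y ^ʸ 1 *ʸ constantʸ (A 1) +ʸ y ^ʸ 2 *ʸ constantʸ (A 2)
      ≈⟨ factor-+₃-weightedʸ y {t₁ = constantʸ f₁} {t₂ = constantʸ (f₁ *ₛ f₂)} (constantʸ-cong A-0)
           (R[[x]][[y]].trans (constantʸ-cong A-1) (constantʸ-* g f₁))
           (R[[x]][[y]].trans (constantʸ-cong A-2) (constantʸ-* g (f₁ *ₛ f₂))) ⟩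
    constantʸ g *ʸ (1ʸ +ʸ y *ʸ constantʸ f₁ +ʸ y ^ʸ 2 *ʸ constantʸ (f₁ *ₛ f₂))
      ≈⟨ rhs-columns ⟨
    columns (ι g *₂ (1₂ +₂ Y *₂ ι f₁ +₂ Y ^₂ 2 *₂ ι (f₁ *ₛ f₂))) ∎)
    where
    open SetoidReasoning R[[x]][[y]].setoid
    open Telescoping seriesRing using () renaming
      (diagonal to diagonalʸ; diagonal-constant to diagonal-constantʸ; telescope-diagonal to telescope-diagonalʸ)
    open Factoring seriesRingʸ using () renaming (factor-+₃-weighted to factor-+₃-weightedʸ)

    lhs-columns : columns ((λ n k → A k n) *₂ (1₂ -₂ Y ^₂ 3 *₂ ι F)) ≈ʸ A *ʸ (1ʸ -ʸ y ^ʸ 3 *ʸ constantʸ F)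
    lhs-columns = R[[x]][[y]].trans (columns-*₂ (λ n k → A k n) (1₂ -₂ Y ^₂ 3 *₂ ι F))
      (*ʸ-congˡ A (R[[x]][[y]].+-cong columns-1₂ (R[[x]][[y]].-‿cong
        (R[[x]][[y]].trans (columns-*ι (Y ^₂ 3) F) (*ʸ-congʳ (constantʸ F) (columns-Y^ 3))))))

    rhs-columns : columns (ι g *₂ (1₂ +₂ Y *₂ ι f₁ +₂ Y ^₂ 2 *₂ ι (f₁ *ₛ f₂)))
                  ≈ʸ constantʸ g *ʸ (1ʸ +ʸ y *ʸ constantʸ f₁ +ʸ y ^ʸ 2 *ʸ constantʸ (f₁ *ₛ f₂))
    rhs-columns = R[[x]][[y]].trans (columns-*₂ (ι g) (1₂ +₂ Y *₂ ι f₁ +₂ Y ^₂ 2 *₂ ι (f₁ *ₛ f₂)))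
      (R[[x]][[y]].*-cong (columns-ι g) (R[[x]][[y]].+-cong
        (R[[x]][[y]].+-cong columns-1₂ (R[[x]][[y]].trans (columns-*ι Y f₁) (*ʸ-congʳ (constantʸ f₁) columns-Y)))
        (R[[x]][[y]].trans (columns-*ι (Y ^₂ 2) (f₁ *ₛ f₂)) (*ʸ-congʳ (constantʸ (f₁ *ₛ f₂)) (columns-Y^ 2)))))

    constant-A-rec : ∀ k → constantʸ (A (3 + k)) ≈ʸ constantʸ (A k) *ʸ constantʸ F
    constant-A-rec k = R[[x]][[y]].trans (constantʸ-cong (A-rec k)) (constantʸ-* (A k) F)

mainTheorem3 : ∀ {c ℓ} (R : CommutativeRing c ℓ) →
  let open PowerSeries R in
  (g f₁ f₂ f₃ : Series) →
  InPow3 g → InXPow3 f₁ → InXPow3 f₂ → InXPow3 f₃ →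
  let a : ℕ → ℕ → CommutativeRing.Carrier R
      a = λ n k → (g *ₛ f₁ ^ₛ ((k + 2) / 3) *ₛ f₂ ^ₛ ((k + 1) / 3) *ₛ f₃ ^ₛ (k / 3)) n
      F = f₁ *ₛ f₂ *ₛ f₃
      rowSums : Series
      rowSums = λ n → sumUpTo (λ k → a n k) n
      diagSums : Series
      diagSums = λ n → sumUpTo (λ k → a (n ∸ k) k) n
  in (a *₂ (1₂ -₂ Y ^₂ 3 *₂ ι F)
        ≈₂ ι g *₂ (1₂ +₂ Y *₂ ι f₁ +₂ Y ^₂ 2 *₂ ι (f₁ *ₛ f₂)))
     × (rowSums *ₛ (1ₛ -ₛ F) ≈ₛ g *ₛ (1ₛ +ₛ f₁ +ₛ f₁ *ₛ f₂))
     × (diagSums *ₛ (1ₛ -ₛ X ^ₛ 3 *ₛ F)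
        ≈ₛ g *ₛ (1ₛ +ₛ X *ₛ f₁ +ₛ X ^ₛ 2 *ₛ (f₁ *ₛ f₂)))
mainTheorem3 R g f₁ f₂ f₃ _ f₁∈ f₂∈ f₃∈ =
  bivariate , rows (A-summable (InXPow3⇒HasOrder1 f₁∈) (InXPow3⇒HasOrder1 f₂∈) (InXPow3⇒HasOrder1 f₃∈)) , diagonals
  where
  open Order R using (InXPow3⇒HasOrder1)
  open PeriodicProducts R g f₁ f₂ f₃
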